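{- Assume the setting below. For all objects $X,Y$, $\alpha\in Q(X)$, $\beta\in Q(Y)$, $$\mu_{X,Y}(\jmath_X(\alpha),\beta)\le\jmath_{X\otimes Y}(\mu_{X,Y}(\alpha,\beta)).$$ Consequently, setting $u^{\jmath}:=\jmath_I(u)$ and $\mu^{\jmath}_{X,Y}:=\jmath_{X\otimes Y}\circ\mu_{X,Y}$ restricted to $Q^\jmath(X)\times Q^\jmath(Y)\to Q^\jmath(X\otimes Y)$, these data make $Q^{\jmath}:\mathsf{C}\to\mathsf{SLatt}$ a monoidal functor (with $\mu^\jmath$ natural and sup-preserving in each variable).
   Context: $(\mathsf{C},\otimes,I,a,\lambda,\rho,\sigma)$ is $*$-autonomous (symmetric monoidal closed, internal hom $\multimap$, counit $\mathrm{ev}_{X,Y}:X\otimes(X\multimap Y)\to Y$, dualizing object $0$). $Q:\mathsf{C}\to\mathsf{SLatt}$ is a monoidal functor into complete lattices and sup-preserving maps, with $u\in Q(I)$ and $\mu_{X,Y}:Q(X)\times Q(Y)\to Q(X\otimes Y)$ sup-preserving in each variable, natural, and satisfying $Q(\lambda_Y)(\mu_{I,Y}(u,y))=y$, $Q(\rho_X)(\mu_{X,I}(x,u))=x$, $Q(a)(\mu(\mu(x,y),z))=\mu(x,\mu(y,z))$, $Q(\sigma_{X,Y})(\mu_{X,Y}(x,y))=\mu_{Y,X}(y,x)$. Put $\langle x,b\rangle_{X,Y}:=Q(\mathrm{ev}_{X,Y})(\mu_{X,X\multimap Y}(x,b))$, $\iota_{X,Y}(\alpha,-)$ its right adjoint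 in $b$. Fix $\omega\in Q(0)$; $X^*:=X\multimap0$, $\omega_X(\alpha):=\iota_{X,0}(\alpha,\omega)$, $\beta^\perp:=\bigvee\{\alpha\in Q(X)\mid\langle\alpha,\beta\rangle_{X,0}\le\omega\}$ for $\beta\in Q(X^*)$, $\jmath_X(\alpha):=(\omega_X(\alpha))^\perp$ (a closure operator). $Q^\jmath(X):=\{\alpha\in Q(X)\mid\jmath_X(\alpha)=\alpha\}$, a complete lattice with joins $\jmath_X(\bigvee\alpha_i)$, and $Q^\jmath(f):=\jmath_Y\circ Q(f)$; $Q^\jmath:\mathsf{C}\to\mathsf{SLatt}$ is a functor. A monoidal functor into $\mathsf{SLatt}$ means the coherence equalities above hold for the given unit element and natural, bilinear multiplication maps. -}

module Defs where

open import Level using (Level; _⊔_; suc)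
open import Data.Product using (Σ; _×_; _,_; proj₁)
open import Data.Unit.Polymorphic using (⊤)
open import Relation.Binary.Structures using (IsEquivalence; IsPartialOrder)

record Category (o h e : Level) : Set (suc (o ⊔ h ⊔ e)) where
  infixr 9 _∘_
  infix 4 _≈_
  field
    Obj   : Set o
    _⇒_   : Obj → Obj → Set h
    _≈_   : ∀ {A B} → A ⇒ B → A ⇒ B → Set e
    ≈-equiv : ∀ {A B} → IsEquivalence (_≈_ {A} {B})
    id    : ∀ {A} → A ⇒ A
    _∘_   : ∀ {A B C} → B ⇒ C → A ⇒ B → A ⇒ C
    assoc : ∀ {A B C D} {f : A ⇒ B} {g : B ⇒ C} {k : C ⇒ D} →
            (k ∘ g) ∘ f ≈ k ∘ (g ∘ f)
    identityˡ : ∀ {A B} {f : A ⇒ B} → id ∘ f ≈ f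
    identityʳ : ∀ {A B} {f : A ⇒ B} → f ∘ id ≈ f
    ∘-resp-≈  : ∀ {A B C} {f f' : B ⇒ C} {g g' : A ⇒ B} →
                f ≈ f' → g ≈ g' → f ∘ g ≈ f' ∘ g'

record SymmetricMonoidal {o h e} (C : Category o h e) : Set (o ⊔ h ⊔ e) where
  open Category C
  infixr 10 _⊗₀_ _⊗₁_
  field
    _⊗₀_ : Obj → Obj → Obj
    _⊗₁_ : ∀ {A B A' B'} → A ⇒ B → A' ⇒ B' → (A ⊗₀ A') ⇒ (B ⊗₀ B')
    I    : Obj
    ⊗-identity : ∀ {A B} → id {A} ⊗₁ id {B} ≈ id
    ⊗-homo : ∀ {A B C A' B' C'} {f : A ⇒ B} {g : B ⇒ C} {f' : A' ⇒ B'} {g' : B' ⇒ C'} →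
             (g ∘ f) ⊗₁ (g' ∘ f') ≈ (g ⊗₁ g') ∘ (f ⊗₁ f')
    ⊗-resp-≈ : ∀ {A B A' B'} {f g : A ⇒ B} {f' g' : A' ⇒ B'} →
               f ≈ g → f' ≈ g' → f ⊗₁ f' ≈ g ⊗₁ g'
    a⇒ : ∀ {X Y Z} → ((X ⊗₀ Y) ⊗₀ Z) ⇒ (X ⊗₀ (Y ⊗₀ Z))
    a⇐ : ∀ {X Y Z} → (X ⊗₀ (Y ⊗₀ Z)) ⇒ ((X ⊗₀ Y) ⊗₀ Z)
    λ⇒ : ∀ {X} → (I ⊗₀ X) ⇒ X
    λ⇐ : ∀ {X} → X ⇒ (I ⊗₀ X)
    ρ⇒ : ∀ {X} → (X ⊗₀ I) ⇒ X
    ρ⇐ : ∀ {X} → X ⇒ (X ⊗₀ I)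
    σ  : ∀ {X Y} → (X ⊗₀ Y) ⇒ (Y ⊗₀ X)
    a-isoˡ : ∀ {X Y Z} → a⇐ {X} {Y} {Z} ∘ a⇒ ≈ id
    a-isoʳ : ∀ {X Y Z} → a⇒ {X} {Y} {Z} ∘ a⇐ ≈ id
    λ-isoˡ : ∀ {X} → λ⇐ {X} ∘ λ⇒ ≈ id
    λ-isoʳ : ∀ {X} → λ⇒ {X} ∘ λ⇐ ≈ id
    ρ-isoˡ : ∀ {X} → ρ⇐ {X} ∘ ρ⇒ ≈ id
    ρ-isoʳ : ∀ {X} → ρ⇒ {X} ∘ ρ⇐ ≈ id
    σ-inv  : ∀ {X Y} → σ {Y} {X} ∘ σ {X} {Y} ≈ id
    a-natural : ∀ {X X' Y Y' Z Z'} {f : X ⇒ X'} {g : Y ⇒ Y'} {k : Z ⇒ Z'} →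
                a⇒ ∘ ((f ⊗₁ g) ⊗₁ k) ≈ (f ⊗₁ (g ⊗₁ k)) ∘ a⇒
    λ-natural : ∀ {X X'} {f : X ⇒ X'} → λ⇒ ∘ (id ⊗₁ f) ≈ f ∘ λ⇒
    ρ-natural : ∀ {X X'} {f : X ⇒ X'} → ρ⇒ ∘ (f ⊗₁ id) ≈ f ∘ ρ⇒
    σ-natural : ∀ {X X' Y Y'} {f : X ⇒ X'} {g : Y ⇒ Y'} →
                σ ∘ (f ⊗₁ g) ≈ (g ⊗₁ f) ∘ σ
    pentagon : ∀ {W X Y Z} →
               (id {W} ⊗₁ a⇒ {X} {Y} {Z}) ∘ (a⇒ ∘ (a⇒ ⊗₁ id))
                 ≈ a⇒ ∘ a⇒
    triangle : ∀ {X Y} → (id {X} ⊗₁ λ⇒ {Y}) ∘ a⇒ ≈ ρ⇒ ⊗₁ id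
    hexagon  : ∀ {X Y Z} →
               a⇒ {Y} {Z} {X} ∘ (σ {X} {Y ⊗₀ Z} ∘ a⇒)
                 ≈ (id ⊗₁ σ {X} {Z}) ∘ (a⇒ ∘ (σ {X} {Y} ⊗₁ id))

record StarAutonomous {o h e} (C : Category o h e) : Set (o ⊔ h ⊔ e) where
  open Category C
  field
    monoidal : SymmetricMonoidal C
  open SymmetricMonoidal monoidal
  infixr 5 _⊸_
  field
    _⊸_   : Obj → Obj → Obj
    ev    : ∀ {X Y} → (X ⊗₀ (X ⊸ Y)) ⇒ Y
    curry : ∀ {X Y Z} → (X ⊗₀ Z) ⇒ Y → Z ⇒ (X ⊸ Y)
    curry-β : ∀ {X Y Z} {f : (X ⊗₀ Z) ⇒ Y} → ev ∘ (id ⊗₁ curry f) ≈ f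
    curry-unique : ∀ {X Y Z} {f : (X ⊗₀ Z) ⇒ Y} {g : Z ⇒ (X ⊸ Y)} →
                   ev ∘ (id ⊗₁ g) ≈ f → g ≈ curry f
    𝟘 : Obj
  dd : ∀ {X} → X ⇒ ((X ⊸ 𝟘) ⊸ 𝟘)
  dd {X} = curry (ev {X} {𝟘} ∘ σ)
  field
    dd⁻¹ : ∀ {X} → ((X ⊸ 𝟘) ⊸ 𝟘) ⇒ X
    dd-isoˡ : ∀ {X} → dd⁻¹ ∘ dd {X} ≈ id
    dd-isoʳ : ∀ {X} → dd {X} ∘ dd⁻¹ ≈ id

record CompleteLattice (ℓ : Level) : Set (suc ℓ) where
  infix 4 _≈_ _≤_
  field
    Carrier : Set ℓ
    _≈_ : Carrier → Carrier → Set ℓ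
    _≤_ : Carrier → Carrier → Set ℓ
    isPartialOrder : IsPartialOrder _≈_ _≤_
    ⋁ : {J : Set ℓ} → (J → Carrier) → Carrier
    ⋁-upper : ∀ {J : Set ℓ} (g : J → Carrier) (i : J) → g i ≤ ⋁ g
    ⋁-least : ∀ {J : Set ℓ} (g : J → Carrier) (z : Carrier) →
              (∀ i → g i ≤ z) → ⋁ g ≤ z

record IsSupMap {ℓ} (L M : CompleteLattice ℓ)
                (f : CompleteLattice.Carrier L → CompleteLattice.Carrier M) : Set (suc ℓ) where
  private
    module L = CompleteLattice L
    module M = CompleteLattice M
  field
    cong : ∀ {x y} → x L.≈ y → f x M.≈ f y
    preserves-⋁ : ∀ {J : Set ℓ} (g : J → L.Carrier) → f (L.⋁ g) M.≈ M.⋁ (λ i → f (g i))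

record SLattFunctor {o h e} (C : Category o h e) (ℓ : Level)
       : Set (o ⊔ h ⊔ e ⊔ suc ℓ) where
  open Category C renaming (_≈_ to _≈C_)
  field
    F₀ : Obj → CompleteLattice ℓ
  open module F₀ X = CompleteLattice (F₀ X) public
    using (Carrier; _≈_; _≤_; ⋁)
  field
    F₁ : ∀ {X Y} → X ⇒ Y → Carrier X → Carrier Y
    F₁-sup : ∀ {X Y} (f : X ⇒ Y) → IsSupMap (F₀ X) (F₀ Y) (F₁ f)
    F-resp-≈ : ∀ {X Y} {f g : X ⇒ Y} → f ≈C g → ∀ x → _≈_ Y (F₁ f x) (F₁ g x)
    F-identity : ∀ {X} (x : Carrier X) → _≈_ X (F₁ id x) x
    F-homomorphism : ∀ {X Y Z} {f : X ⇒ Y} {g : Y ⇒ Z} (x : Carrier X) →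
                     _≈_ Z (F₁ (g ∘ f) x) (F₁ g (F₁ f x))

-- With P trivial, J = ⋁ and F = F₁ this is exactly the notion of a
-- monoidal functor into SLatt; with P = fixed points of a closure
-- operator it expresses the monoidality of the restricted functor.

record IsMonoidalOn {o h e ℓ} {C : Category o h e} (M : SymmetricMonoidal C)
       (Car : Category.Obj C → Set ℓ)
       (_≈_ : ∀ X → Car X → Car X → Set ℓ)
       (P : ∀ X → Car X → Set ℓ)
       (J : ∀ X {K : Set ℓ} → (K → Car X) → Car X)
       (F : ∀ {X Y} → Category._⇒_ C X Y → Car X → Car Y)
       (u : Car (SymmetricMonoidal.I M))
       (m : ∀ X Y → Car X → Car Y → Car (SymmetricMonoidal._⊗₀_ M X Y))
       : Set (o ⊔ h ⊔ suc ℓ) where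
  open Category C hiding (_≈_)
  open SymmetricMonoidal M
  field
    unit-in : P I u
    mult-in : ∀ {X Y x y} → P X x → P Y y → P (X ⊗₀ Y) (m X Y x y)
    mult-cong : ∀ {X Y x x' y y'} → P X x → P X x' → P Y y → P Y y' →
                _≈_ X x x' → _≈_ Y y y' → _≈_ (X ⊗₀ Y) (m X Y x y) (m X Y x' y')
    mult-supˡ : ∀ {X Y} {K : Set ℓ} (g : K → Car X) {y} →
                (∀ k → P X (g k)) → P Y y →
                _≈_ (X ⊗₀ Y) (m X Y (J X g) y) (J (X ⊗₀ Y) (λ k → m X Y (g k) y))
    mult-supʳ : ∀ {X Y} {K : Set ℓ} {x} (g : K → Car Y) →
                P X x → (∀ k → P Y (g k)) →
                _≈_ (X ⊗₀ Y) (m X Y x (J Y g)) (J (X ⊗₀ Y) (λ k → m X Y x (g k)))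
    natural : ∀ {X X' Y Y'} (f : X ⇒ X') (g : Y ⇒ Y') {x y} → P X x → P Y y →
              _≈_ (X' ⊗₀ Y') (F (f ⊗₁ g) (m X Y x y)) (m X' Y' (F f x) (F g y))
    unitˡ : ∀ {Y y} → P Y y → _≈_ Y (F λ⇒ (m I Y u y)) y
    unitʳ : ∀ {X x} → P X x → _≈_ X (F ρ⇒ (m X I x u)) x
    assoc : ∀ {X Y Z x y z} → P X x → P Y y → P Z z →
            _≈_ (X ⊗₀ (Y ⊗₀ Z)) (F a⇒ (m (X ⊗₀ Y) Z (m X Y x y) z))
                                (m X (Y ⊗₀ Z) x (m Y Z y z))
    symm : ∀ {X Y x y} → P X x → P Y y →
           _≈_ (Y ⊗₀ X) (F σ (m X Y x y)) (m Y X y x)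

record MonoidalSLattFunctor {o h e} {C : Category o h e}
       (M : SymmetricMonoidal C) (ℓ : Level) : Set (o ⊔ h ⊔ e ⊔ suc ℓ) where
  open SymmetricMonoidal M
  field
    functor : SLattFunctor C ℓ
  open SLattFunctor functor public
  field
    u : Carrier I
    μ : ∀ X Y → Carrier X → Carrier Y → Carrier (X ⊗₀ Y)
    isMonoidal : IsMonoidalOn M Carrier _≈_ (λ _ _ → ⊤) ⋁ F₁ u μ

module Closure {o h e ℓ} {C : Category o h e} (S : StarAutonomous C)
       (Q : MonoidalSLattFunctor (StarAutonomous.monoidal S) ℓ) where
  open Category C hiding (_≈_)
  open StarAutonomous S
  open SymmetricMonoidal monoidal
  open MonoidalSLattFunctor Q

  pair : ∀ X Y → Carrier X → Carrier (X ⊸ Y) → Carrier Y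
  pair X Y x b = F₁ (ev {X} {Y}) (μ X (X ⊸ Y) x b)

  -- ι_{X,Y}(α, -) : the right adjoint of ⟨α , -⟩_{X,Y}
  ι : ∀ X Y → Carrier X → Carrier Y → Carrier (X ⊸ Y)
  ι X Y α γ = ⋁ (X ⊸ Y) {Σ (Carrier (X ⊸ Y)) (λ b → _≤_ Y (pair X Y α b) γ)} proj₁

  module _ (ω : Carrier 𝟘) where
    ωₓ : ∀ X → Carrier X → Carrier (X ⊸ 𝟘)
    ωₓ X α = ι X 𝟘 α ω

    perp : ∀ X → Carrier (X ⊸ 𝟘) → Carrier X
    perp X β = ⋁ X {Σ (Carrier X) (λ α → _≤_ 𝟘 (pair X 𝟘 α β) ω)} proj₁

    ȷ : ∀ X → Carrier X → Carrier X
    ȷ X α = perp X (ωₓ X α)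

    -- Q^ȷ(X) = fixed points of ȷ_X, with joins ȷ_X(⋁ α_i) and Q^ȷ(f) = ȷ ∘ Q(f)
    Fixed : ∀ X → Carrier X → Set ℓ
    Fixed X α = _≈_ X (ȷ X α) α

    ⋁ȷ : ∀ X {K : Set ℓ} → (K → Carrier X) → Carrier X
    ⋁ȷ X g = ȷ X (⋁ X g)

    Qȷ₁ : ∀ {X Y} → X ⇒ Y → Carrier X → Carrier Y
    Qȷ₁ {X} {Y} f α = ȷ Y (F₁ f α)

    uȷ : Carrier I
    uȷ = ȷ I u

    μȷ : ∀ X Y → Carrier X → Carrier Y → Carrier (X ⊗₀ Y)
    μȷ X Y α β = ȷ (X ⊗₀ Y) (μ X Y α β)

{-# OPTIONS --safe #-}
module Submission where

-- The pairing ⟨_,_⟩ into Q(𝟘) makes ȷ = (ω_(-))^⊥ the closure operator of the Galois connection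
-- α ≤ β^⊥ ⇔ ⟨α, β⟩ ≤ ω ⇔ β ≤ ω_X(α).  A map φ : Q(X) → Q(Z) with a transpose ψ along the
-- pairing, ⟨φ x, c⟩ = ⟨x, ψ c⟩, satisfies φ (ȷ α) ≤ ȷ (φ α); by currying, Q(f) and μ(-, β) have
-- such transposes, which gives the inequality.  Consequently the relation a ∼ b :⇔ ȷ a = ȷ b is
-- respected by ⋁, by every Q(f) and by μ in each variable, and since ȷ α ∼ α every law of (u, μ)
-- descends to the corresponding law of (uȷ, μȷ) on the fixed points.

open import Level using (Level)
open import Data.Product using (_×_; _,_; Σ; proj₁; proj₂)
open import Data.Unit.Polymorphic using (tt)
open import Relation.Binary.Bundles using (Poset; Setoid)
import Relation.Binary.Reasoning.Setoid as SetoidReasoning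
import Relation.Binary.Reasoning.PartialOrder as PosetReasoning
open import Defs

module CompleteLatticeProperties {ℓ} (L : CompleteLattice ℓ) where
  open CompleteLattice L

  poset : Poset ℓ ℓ ℓ
  poset = record { isPartialOrder = isPartialOrder }

  open Poset poset public using (refl; reflexive; trans; antisym; module Eq)

  ⋁-downset : ∀ b → ⋁ {Σ Carrier (_≤ b)} proj₁ ≈ b
  ⋁-downset b = antisym (⋁-least proj₁ b proj₂) (⋁-upper proj₁ (b , refl))

module _ {ℓ} {L M : CompleteLattice ℓ} where
  private
    module L = CompleteLattice L
    module M = CompleteLattice M
    module LP = CompleteLatticeProperties L
    module MP = CompleteLatticeProperties M

  supMap-monotone : ∀ {f} → IsSupMap L M f → ∀ {a b} → a L.≤ b → f a M.≤ f b
  supMap-monotone {f} isSup {a} {b} a≤b =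
    MP.trans (M.⋁-upper (λ i → f (proj₁ i)) (a , a≤b))
             (MP.reflexive (MP.Eq.trans (MP.Eq.sym (preserves-⋁ proj₁))
                                        (cong (LP.⋁-downset b))))
    where open IsSupMap isSup

  supMap-⋁-least : ∀ {f} → IsSupMap L M f → ∀ {J : Set ℓ} (g : J → L.Carrier) {z} →
                   (∀ i → f (g i) M.≤ z) → f (L.⋁ g) M.≤ z
  supMap-⋁-least isSup g {z} bounded =
    MP.trans (MP.reflexive (IsSupMap.preserves-⋁ isSup g)) (M.⋁-least _ z bounded)

  ∘-isSupMap : ∀ {K : CompleteLattice ℓ} {f g} → IsSupMap M K g → IsSupMap L M f →
               IsSupMap L K (λ a → g (f a))
  ∘-isSupMap {K} {f} {g} g-sup f-sup = record
    { cong        = λ p → G.cong (F.cong p)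
    ; preserves-⋁ = λ h → KP.Eq.trans (G.cong (F.preserves-⋁ h)) (G.preserves-⋁ _)
    }
    where
    module F = IsSupMap f-sup
    module G = IsSupMap g-sup
    module KP = CompleteLatticeProperties K

record IsClosureOperator {ℓ} (L : CompleteLattice ℓ)
       (j : CompleteLattice.Carrier L → CompleteLattice.Carrier L) : Set ℓ where
  open CompleteLattice L
  field
    extensive  : ∀ {a} → a ≤ j a
    monotone   : ∀ {a b} → a ≤ b → j a ≤ j b
    idempotent : ∀ {a} → j (j a) ≤ j a

module ClosureOperatorProperties {ℓ} {L : CompleteLattice ℓ} {j}
       (isClosure : IsClosureOperator L j) where
  open CompleteLattice L
  open CompleteLatticeProperties L
  open IsClosureOperator isClosure

  infix 4 _∼_
  _∼_ : Carrier → Carrier → Set ℓ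
  a ∼ b = j a ≈ j b

  ≤j⇒j≤j : ∀ {a b} → a ≤ j b → j a ≤ j b
  ≤j⇒j≤j a≤jb = trans (monotone a≤jb) idempotent

  ≤j⇒∼ : ∀ {a b} → a ≤ j b → b ≤ j a → a ∼ b
  ≤j⇒∼ a≤jb b≤ja = antisym (≤j⇒j≤j a≤jb) (≤j⇒j≤j b≤ja)

  ≈⇒∼ : ∀ {a b} → a ≈ b → a ∼ b
  ≈⇒∼ a≈b = ≤j⇒∼ (trans (reflexive a≈b) extensive) (trans (reflexive (Eq.sym a≈b)) extensive)

  j∼ : ∀ {a} → j a ∼ a
  j∼ = antisym idempotent extensive

  ∼-setoid : Setoid ℓ ℓ
  ∼-setoid = record
    { Carrier       = Carrier
    ; _≈_           = _∼_
    ; isEquivalence = record { refl = Eq.refl ; sym = Eq.sym ; trans = Eq.trans }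
    }

  ⋁-resp-∼ : ∀ {J : Set ℓ} {g g' : J → Carrier} → (∀ i → g i ∼ g' i) → ⋁ g ∼ ⋁ g'
  ⋁-resp-∼ {g = g} {g'} g∼g' = ≤j⇒∼ (⋁≤j⋁ g g' g∼g') (⋁≤j⋁ g' g (λ i → Eq.sym (g∼g' i)))
    where
    ⋁≤j⋁ : ∀ h h' → (∀ i → h i ∼ h' i) → ⋁ h ≤ j (⋁ h')
    ⋁≤j⋁ h h' h∼h' = ⋁-least h _ λ i →
      trans extensive (trans (reflexive (h∼h' i)) (monotone (⋁-upper h' i)))

  fixed-∼ : ∀ {a b} → j b ≈ b → a ∼ b → j a ≈ b
  fixed-∼ fixed a∼b = Eq.trans a∼b fixed

module _ {ℓ} {L M : CompleteLattice ℓ} {jL jM}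
         (L-closure : IsClosureOperator L jL) (M-closure : IsClosureOperator M jM) where
  private
    module L = CompleteLattice L
    module M = CompleteLattice M
    module LP = CompleteLatticeProperties L
    module MP = CompleteLatticeProperties M
    module LC = ClosureOperatorProperties L-closure
    module MC = ClosureOperatorProperties M-closure

  lax-resp-∼ : (φ : L.Carrier → M.Carrier) → (∀ {a b} → a L.≤ b → φ a M.≤ φ b) → (∀ a → φ (jL a) M.≤ jM (φ a)) →
               ∀ {a b} → a LC.∼ b → φ a MC.∼ φ b
  lax-resp-∼ φ φ-mono φ-lax a∼b = MC.≤j⇒∼ (bound a∼b) (bound (LP.Eq.sym a∼b))
    where
    bound : ∀ {a b} → a LC.∼ b → φ a M.≤ jM (φ b)
    bound {a} {b} a∼b =
      MP.trans (φ-mono (IsClosureOperator.extensive L-closure))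
        (MP.trans (φ-mono (LP.reflexive a∼b)) (φ-lax b))

module MonoidalSLattFunctorProperties {o h e ℓ} {C : Category o h e} (S : StarAutonomous C)
       (Q : MonoidalSLattFunctor (StarAutonomous.monoidal S) ℓ) where
  open Category C hiding (_≈_; assoc)
  open StarAutonomous S
  open SymmetricMonoidal monoidal
  open MonoidalSLattFunctor Q
  open Closure S Q
  private
    module Q = IsMonoidalOn isMonoidal
    module L {X} = CompleteLatticeProperties (F₀ X)
    module ≈-Reasoning X = SetoidReasoning (L.Eq.setoid {X})

  F₁-monotone : ∀ {X Y} (f : X ⇒ Y) {a b} → _≤_ X a b → _≤_ Y (F₁ f a) (F₁ f b)
  F₁-monotone f = supMap-monotone (F₁-sup f)

  μ-cong : ∀ {X Y a a' b b'} → _≈_ X a a' → _≈_ Y b b' → _≈_ (X ⊗₀ Y) (μ X Y a b) (μ X Y a' b')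
  μ-cong = Q.mult-cong tt tt tt tt

  μˡ-isSupMap : ∀ {X Y} b → IsSupMap (F₀ X) (F₀ (X ⊗₀ Y)) (λ a → μ X Y a b)
  μˡ-isSupMap b = record
    { cong        = λ p → μ-cong p L.Eq.refl
    ; preserves-⋁ = λ g → Q.mult-supˡ g (λ _ → tt) tt
    }

  μʳ-isSupMap : ∀ {X Y} a → IsSupMap (F₀ Y) (F₀ (X ⊗₀ Y)) (μ X Y a)
  μʳ-isSupMap a = record
    { cong        = μ-cong L.Eq.refl
    ; preserves-⋁ = λ g → Q.mult-supʳ g tt (λ _ → tt)
    }

  μ-monotoneˡ : ∀ {X Y a a' b} → _≤_ X a a' → _≤_ (X ⊗₀ Y) (μ X Y a b) (μ X Y a' b)
  μ-monotoneˡ {b = b} = supMap-monotone (μˡ-isSupMap b)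

  μ-monotoneʳ : ∀ {X Y a b b'} → _≤_ Y b b' → _≤_ (X ⊗₀ Y) (μ X Y a b) (μ X Y a b')
  μ-monotoneʳ {a = a} = supMap-monotone (μʳ-isSupMap a)

  μ-naturalˡ : ∀ {X X' Y} (f : X ⇒ X') x y →
               _≈_ (X' ⊗₀ Y) (F₁ (f ⊗₁ id) (μ X Y x y)) (μ X' Y (F₁ f x) y)
  μ-naturalˡ f x y = L.Eq.trans (Q.natural f id tt tt) (μ-cong L.Eq.refl (F-identity y))

  μ-naturalʳ : ∀ {X Y Y'} (g : Y ⇒ Y') x y →
               _≈_ (X ⊗₀ Y') (F₁ (id ⊗₁ g) (μ X Y x y)) (μ X Y' x (F₁ g y))
  μ-naturalʳ g x y = L.Eq.trans (Q.natural id g tt tt) (μ-cong (F-identity x) L.Eq.refl)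

  μ-assoc⁻¹ : ∀ {X Y Z} x y z →
              _≈_ ((X ⊗₀ Y) ⊗₀ Z) (μ (X ⊗₀ Y) Z (μ X Y x y) z) (F₁ a⇐ (μ X (Y ⊗₀ Z) x (μ Y Z y z)))
  μ-assoc⁻¹ {X} {Y} {Z} x y z = begin
    m                   ≈⟨ F-identity m ⟨
    F₁ id m             ≈⟨ F-resp-≈ a-isoˡ m ⟨
    F₁ (a⇐ ∘ a⇒) m      ≈⟨ F-homomorphism m ⟩
    F₁ a⇐ (F₁ a⇒ m)     ≈⟨ IsSupMap.cong (F₁-sup a⇐) (Q.assoc tt tt tt) ⟩
    F₁ a⇐ (μ X (Y ⊗₀ Z) x (μ Y Z y z)) ∎
    where
    open ≈-Reasoning ((X ⊗₀ Y) ⊗₀ Z)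
    m = μ (X ⊗₀ Y) Z (μ X Y x y) z

  pairˡ-isSupMap : ∀ {X Y} b → IsSupMap (F₀ X) (F₀ Y) (λ a → pair X Y a b)
  pairˡ-isSupMap b = ∘-isSupMap (F₁-sup ev) (μˡ-isSupMap b)

  pairʳ-isSupMap : ∀ {X Y} a → IsSupMap (F₀ (X ⊸ Y)) (F₀ Y) (pair X Y a)
  pairʳ-isSupMap a = ∘-isSupMap (F₁-sup ev) (μʳ-isSupMap a)

  pair-curry : ∀ {X Y Z} (k : (X ⊗₀ Z) ⇒ Y) x c →
               _≈_ Y (pair X Y x (F₁ (curry k) c)) (F₁ k (μ X Z x c))
  pair-curry {X} {Y} {Z} k x c = begin
    F₁ ev (μ X (X ⊸ Y) x (F₁ (curry k) c))  ≈⟨ IsSupMap.cong (F₁-sup ev) (μ-naturalʳ (curry k) x c) ⟨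
    F₁ ev (F₁ (id ⊗₁ curry k) (μ X Z x c))  ≈⟨ F-homomorphism (μ X Z x c) ⟨
    F₁ (ev ∘ (id ⊗₁ curry k)) (μ X Z x c)   ≈⟨ F-resp-≈ curry-β (μ X Z x c) ⟩
    F₁ k (μ X Z x c)                        ∎
    where open ≈-Reasoning Y

  module _ (ω : Carrier 𝟘) where

    pair-perp≤ω : ∀ {X} β → _≤_ 𝟘 (pair X 𝟘 (perp ω X β) β) ω
    pair-perp≤ω β = supMap-⋁-least (pairˡ-isSupMap β) proj₁ proj₂

    pair-ωₓ≤ω : ∀ {X} α → _≤_ 𝟘 (pair X 𝟘 α (ωₓ ω X α)) ω
    pair-ωₓ≤ω α = supMap-⋁-least (pairʳ-isSupMap α) proj₁ proj₂

    ≤perp⇒pair≤ω : ∀ {X α β} → _≤_ X α (perp ω X β) → _≤_ 𝟘 (pair X 𝟘 α β) ω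
    ≤perp⇒pair≤ω {β = β} α≤ = L.trans (supMap-monotone (pairˡ-isSupMap β) α≤) (pair-perp≤ω β)

    pair≤ω⇒≤perp : ∀ {X α β} → _≤_ 𝟘 (pair X 𝟘 α β) ω → _≤_ X α (perp ω X β)
    pair≤ω⇒≤perp {X} {α} ⟨α,β⟩≤ω = CompleteLattice.⋁-upper (F₀ X) proj₁ (α , ⟨α,β⟩≤ω)

    pair≤ω⇒≤ωₓ : ∀ {X α β} → _≤_ 𝟘 (pair X 𝟘 α β) ω → _≤_ (X ⊸ 𝟘) β (ωₓ ω X α)
    pair≤ω⇒≤ωₓ {X} {β = β} ⟨α,β⟩≤ω = CompleteLattice.⋁-upper (F₀ (X ⊸ 𝟘)) proj₁ (β , ⟨α,β⟩≤ω)

    perp-antitone : ∀ {X β β'} → _≤_ (X ⊸ 𝟘) β β' → _≤_ X (perp ω X β') (perp ω X β)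
    perp-antitone {X} β≤β' = CompleteLattice.⋁-least (F₀ X) proj₁ _ λ i →
      pair≤ω⇒≤perp (L.trans (supMap-monotone (pairʳ-isSupMap (proj₁ i)) β≤β') (proj₂ i))

    pair-ȷ≤ω : ∀ {X α β} → _≤_ 𝟘 (pair X 𝟘 α β) ω → _≤_ 𝟘 (pair X 𝟘 (ȷ ω X α) β) ω
    pair-ȷ≤ω ⟨α,β⟩≤ω = ≤perp⇒pair≤ω (perp-antitone (pair≤ω⇒≤ωₓ ⟨α,β⟩≤ω))

    ȷ-isClosureOperator : ∀ X → IsClosureOperator (F₀ X) (ȷ ω X)
    ȷ-isClosureOperator X = record
      { extensive  = pair≤ω⇒≤perp (pair-ωₓ≤ω _)
      ; monotone   = λ a≤b → pair≤ω⇒≤perp (pair-ȷ≤ω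
          (L.trans (supMap-monotone (pairˡ-isSupMap _) a≤b) (pair-ωₓ≤ω _)))
      ; idempotent = pair≤ω⇒≤perp (pair-ȷ≤ω (pair-ȷ≤ω (pair-ωₓ≤ω _)))
      }

    module ȷ {X} = ClosureOperatorProperties (ȷ-isClosureOperator X)

    ȷ-lax : ∀ {X Z} (φ : Carrier X → Carrier Z) (ψ : Carrier (Z ⊸ 𝟘) → Carrier (X ⊸ 𝟘)) →
            (∀ x c → _≈_ 𝟘 (pair Z 𝟘 (φ x) c) (pair X 𝟘 x (ψ c))) →
            ∀ α → _≤_ Z (φ (ȷ ω X α)) (ȷ ω Z (φ α))
    ȷ-lax φ ψ transpose α = pair≤ω⇒≤perp (L.trans (L.reflexive (transpose (ȷ ω _ α) c))
      (pair-ȷ≤ω (L.trans (L.reflexive (L.Eq.sym (transpose α c))) (pair-ωₓ≤ω (φ α)))))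
      where c = ωₓ ω _ (φ α)

    F₁-ȷ-lax : ∀ {X Z} (f : X ⇒ Z) α → _≤_ Z (F₁ f (ȷ ω X α)) (ȷ ω Z (F₁ f α))
    F₁-ȷ-lax {X} {Z} f = ȷ-lax (F₁ f) (F₁ (curry (ev ∘ (f ⊗₁ id)))) λ x c → begin
      F₁ ev (μ Z (Z ⊸ 𝟘) (F₁ f x) c)          ≈⟨ IsSupMap.cong (F₁-sup ev) (μ-naturalˡ f x c) ⟨
      F₁ ev (F₁ (f ⊗₁ id) (μ X (Z ⊸ 𝟘) x c))  ≈⟨ F-homomorphism (μ X (Z ⊸ 𝟘) x c) ⟨
      F₁ (ev ∘ (f ⊗₁ id)) (μ X (Z ⊸ 𝟘) x c)   ≈⟨ pair-curry (ev ∘ (f ⊗₁ id)) x c ⟨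
      pair X 𝟘 x (F₁ (curry (ev ∘ (f ⊗₁ id))) c) ∎
      where open ≈-Reasoning 𝟘

    μ-ȷ-laxˡ : ∀ X Y α β → _≤_ (X ⊗₀ Y) (μ X Y (ȷ ω X α) β) (ȷ ω (X ⊗₀ Y) (μ X Y α β))
    μ-ȷ-laxˡ X Y α β = ȷ-lax (λ x → μ X Y x β) (λ c → F₁ (curry (ev ∘ a⇐)) (μ Y W β c)) transpose α
      where
      W = (X ⊗₀ Y) ⊸ 𝟘
      transpose : ∀ x c → _≈_ 𝟘 (pair (X ⊗₀ Y) 𝟘 (μ X Y x β) c)
                                 (pair X 𝟘 x (F₁ (curry (ev ∘ a⇐)) (μ Y W β c)))
      transpose x c = begin
        F₁ ev (μ (X ⊗₀ Y) W (μ X Y x β) c)          ≈⟨ IsSupMap.cong (F₁-sup ev) (μ-assoc⁻¹ x β c) ⟩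
        F₁ ev (F₁ a⇐ (μ X (Y ⊗₀ W) x (μ Y W β c)))  ≈⟨ F-homomorphism (μ X (Y ⊗₀ W) x (μ Y W β c)) ⟨
        F₁ (ev ∘ a⇐) (μ X (Y ⊗₀ W) x (μ Y W β c))   ≈⟨ pair-curry (ev ∘ a⇐) x (μ Y W β c) ⟨
        pair X 𝟘 x (F₁ (curry (ev ∘ a⇐)) (μ Y W β c)) ∎
        where open ≈-Reasoning 𝟘

    μ-ȷ-laxʳ : ∀ X Y α β → _≤_ (X ⊗₀ Y) (μ X Y α (ȷ ω Y β)) (ȷ ω (X ⊗₀ Y) (μ X Y α β))
    μ-ȷ-laxʳ X Y α β = begin
      μ X Y α (ȷ ω Y β)             ≈⟨ Q.symm tt tt ⟨
      F₁ σ (μ Y X (ȷ ω Y β) α)      ≤⟨ F₁-monotone σ (μ-ȷ-laxˡ Y X β α) ⟩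
      F₁ σ (ȷ ω (Y ⊗₀ X) (μ Y X β α)) ≤⟨ F₁-ȷ-lax σ (μ Y X β α) ⟩
      ȷ ω (X ⊗₀ Y) (F₁ σ (μ Y X β α)) ≈⟨ ȷ.≈⇒∼ (Q.symm tt tt) ⟩
      ȷ ω (X ⊗₀ Y) (μ X Y α β)      ∎
      where open PosetReasoning (L.poset {X ⊗₀ Y})

    F₁-resp-∼ : ∀ {X Y} (f : X ⇒ Y) {a b} → a ȷ.∼ b → F₁ f a ȷ.∼ F₁ f b
    F₁-resp-∼ f = lax-resp-∼ (ȷ-isClosureOperator _) (ȷ-isClosureOperator _)
                    (F₁ f) (F₁-monotone f) (F₁-ȷ-lax f)

    μ-respˡ-∼ : ∀ {X Y a a' b} → a ȷ.∼ a' → μ X Y a b ȷ.∼ μ X Y a' b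
    μ-respˡ-∼ {X} {Y} {b = b} = lax-resp-∼ (ȷ-isClosureOperator _) (ȷ-isClosureOperator _)
                                  (λ a → μ X Y a b) μ-monotoneˡ (λ a → μ-ȷ-laxˡ X Y a b)

    μ-respʳ-∼ : ∀ {X Y a b b'} → b ȷ.∼ b' → μ X Y a b ȷ.∼ μ X Y a b'
    μ-respʳ-∼ {X} {Y} {a} = lax-resp-∼ (ȷ-isClosureOperator _) (ȷ-isClosureOperator _)
                              (μ X Y a) μ-monotoneʳ (μ-ȷ-laxʳ X Y a)

    private
      module ∼-Reasoning X = SetoidReasoning (ȷ.∼-setoid {X})

    μȷ-supˡ : ∀ {X Y} {K : Set ℓ} (g : K → Carrier X) y →
              _≈_ (X ⊗₀ Y) (μȷ ω X Y (⋁ȷ ω X g) y) (⋁ȷ ω (X ⊗₀ Y) (λ k → μȷ ω X Y (g k) y))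
    μȷ-supˡ {X} {Y} g y = begin
      μ X Y (ȷ ω X (⋁ X g)) y            ≈⟨ μ-respˡ-∼ ȷ.j∼ ⟩
      μ X Y (⋁ X g) y                    ≈⟨ ȷ.≈⇒∼ (Q.mult-supˡ g (λ _ → tt) tt) ⟩
      ⋁ (X ⊗₀ Y) (λ k → μ X Y (g k) y)   ≈⟨ ȷ.⋁-resp-∼ (λ _ → ȷ.j∼) ⟨
      ⋁ (X ⊗₀ Y) (λ k → μȷ ω X Y (g k) y) ∎
      where open ∼-Reasoning (X ⊗₀ Y)

    μȷ-supʳ : ∀ {X Y} {K : Set ℓ} x (g : K → Carrier Y) →
              _≈_ (X ⊗₀ Y) (μȷ ω X Y x (⋁ȷ ω Y g)) (⋁ȷ ω (X ⊗₀ Y) (λ k → μȷ ω X Y x (g k)))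
    μȷ-supʳ {X} {Y} x g = begin
      μ X Y x (ȷ ω Y (⋁ Y g))            ≈⟨ μ-respʳ-∼ ȷ.j∼ ⟩
      μ X Y x (⋁ Y g)                    ≈⟨ ȷ.≈⇒∼ (Q.mult-supʳ g tt (λ _ → tt)) ⟩
      ⋁ (X ⊗₀ Y) (λ k → μ X Y x (g k))   ≈⟨ ȷ.⋁-resp-∼ (λ _ → ȷ.j∼) ⟨
      ⋁ (X ⊗₀ Y) (λ k → μȷ ω X Y x (g k)) ∎
      where open ∼-Reasoning (X ⊗₀ Y)

    μȷ-natural : ∀ {X X' Y Y'} (f : X ⇒ X') (g : Y ⇒ Y') x y →
                 _≈_ (X' ⊗₀ Y') (Qȷ₁ ω (f ⊗₁ g) (μȷ ω X Y x y))
                                (μȷ ω X' Y' (Qȷ₁ ω f x) (Qȷ₁ ω g y))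
    μȷ-natural {X} {X'} {Y} {Y'} f g x y = begin
      F₁ (f ⊗₁ g) (μȷ ω X Y x y)           ≈⟨ F₁-resp-∼ (f ⊗₁ g) ȷ.j∼ ⟩
      F₁ (f ⊗₁ g) (μ X Y x y)              ≈⟨ ȷ.≈⇒∼ (Q.natural f g tt tt) ⟩
      μ X' Y' (F₁ f x) (F₁ g y)            ≈⟨ μ-respˡ-∼ ȷ.j∼ ⟨
      μ X' Y' (Qȷ₁ ω f x) (F₁ g y)         ≈⟨ μ-respʳ-∼ ȷ.j∼ ⟨
      μ X' Y' (Qȷ₁ ω f x) (Qȷ₁ ω g y)      ∎
      where open ∼-Reasoning (X' ⊗₀ Y')

    μȷ-unitˡ : ∀ {Y y} → Fixed ω Y y → _≈_ Y (Qȷ₁ ω λ⇒ (μȷ ω I Y (uȷ ω) y)) y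
    μȷ-unitˡ {Y} {y} y-fixed = ȷ.fixed-∼ y-fixed (begin
      F₁ λ⇒ (μȷ ω I Y (uȷ ω) y)  ≈⟨ F₁-resp-∼ λ⇒ ȷ.j∼ ⟩
      F₁ λ⇒ (μ I Y (uȷ ω) y)     ≈⟨ F₁-resp-∼ λ⇒ (μ-respˡ-∼ ȷ.j∼) ⟩
      F₁ λ⇒ (μ I Y u y)          ≈⟨ ȷ.≈⇒∼ (Q.unitˡ tt) ⟩
      y                          ∎)
      where open ∼-Reasoning Y

    μȷ-unitʳ : ∀ {X x} → Fixed ω X x → _≈_ X (Qȷ₁ ω ρ⇒ (μȷ ω X I x (uȷ ω))) x
    μȷ-unitʳ {X} {x} x-fixed = ȷ.fixed-∼ x-fixed (begin
      F₁ ρ⇒ (μȷ ω X I x (uȷ ω))  ≈⟨ F₁-resp-∼ ρ⇒ ȷ.j∼ ⟩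
      F₁ ρ⇒ (μ X I x (uȷ ω))     ≈⟨ F₁-resp-∼ ρ⇒ (μ-respʳ-∼ ȷ.j∼) ⟩
      F₁ ρ⇒ (μ X I x u)          ≈⟨ ȷ.≈⇒∼ (Q.unitʳ tt) ⟩
      x                          ∎)
      where open ∼-Reasoning X

    μȷ-assoc : ∀ {X Y Z} x y z →
               _≈_ (X ⊗₀ (Y ⊗₀ Z)) (Qȷ₁ ω a⇒ (μȷ ω (X ⊗₀ Y) Z (μȷ ω X Y x y) z))
                                   (μȷ ω X (Y ⊗₀ Z) x (μȷ ω Y Z y z))
    μȷ-assoc {X} {Y} {Z} x y z = begin
      F₁ a⇒ (μȷ ω (X ⊗₀ Y) Z (μȷ ω X Y x y) z)  ≈⟨ F₁-resp-∼ a⇒ ȷ.j∼ ⟩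
      F₁ a⇒ (μ (X ⊗₀ Y) Z (μȷ ω X Y x y) z)     ≈⟨ F₁-resp-∼ a⇒ (μ-respˡ-∼ ȷ.j∼) ⟩
      F₁ a⇒ (μ (X ⊗₀ Y) Z (μ X Y x y) z)        ≈⟨ ȷ.≈⇒∼ (Q.assoc tt tt tt) ⟩
      μ X (Y ⊗₀ Z) x (μ Y Z y z)                ≈⟨ μ-respʳ-∼ ȷ.j∼ ⟨
      μ X (Y ⊗₀ Z) x (μȷ ω Y Z y z)             ∎
      where open ∼-Reasoning (X ⊗₀ (Y ⊗₀ Z))

    μȷ-symm : ∀ {X Y} x y → _≈_ (Y ⊗₀ X) (Qȷ₁ ω σ (μȷ ω X Y x y)) (μȷ ω Y X y x)
    μȷ-symm {X} {Y} x y = begin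
      F₁ σ (μȷ ω X Y x y)  ≈⟨ F₁-resp-∼ σ ȷ.j∼ ⟩
      F₁ σ (μ X Y x y)     ≈⟨ ȷ.≈⇒∼ (Q.symm tt tt) ⟩
      μ Y X y x            ∎
      where open ∼-Reasoning (Y ⊗₀ X)

    Qȷ-isMonoidal : IsMonoidalOn monoidal Carrier _≈_ (Fixed ω) (⋁ȷ ω) (Qȷ₁ ω) (uȷ ω) (μȷ ω)
    Qȷ-isMonoidal = record
      { unit-in   = ȷ.j∼
      ; mult-in   = λ _ _ → ȷ.j∼
      ; mult-cong = λ _ _ _ _ x≈x' y≈y' → ȷ.≈⇒∼ (μ-cong x≈x' y≈y')
      ; mult-supˡ = λ g _ _ → μȷ-supˡ g _
      ; mult-supʳ = λ g _ _ → μȷ-supʳ _ g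
      ; natural   = λ f g _ _ → μȷ-natural f g _ _
      ; unitˡ     = μȷ-unitˡ
      ; unitʳ     = μȷ-unitʳ
      ; assoc     = λ _ _ _ → μȷ-assoc _ _ _
      ; symm      = λ _ _ → μȷ-symm _ _
      }

open SymmetricMonoidal using (_⊗₀_)
open MonoidalSLattFunctor using (Carrier; _≤_; _≈_; μ)
open Closure using (ȷ; Fixed; ⋁ȷ; Qȷ₁; uȷ; μȷ)

mainTheorem13 : ∀ {o h e ℓ : Level} {C : Category o h e} (S : StarAutonomous C)
                  (Q : MonoidalSLattFunctor (StarAutonomous.monoidal S) ℓ)
                  (ω : Carrier Q (StarAutonomous.𝟘 S)) →
                  (∀ (X Y : Category.Obj C) (α : Carrier Q X) (β : Carrier Q Y) →
                     _≤_ Q (_⊗₀_ (StarAutonomous.monoidal S) X Y)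
                       (μ Q X Y (ȷ S Q ω X α) β)
                       (ȷ S Q ω (_⊗₀_ (StarAutonomous.monoidal S) X Y) (μ Q X Y α β)))
                  × IsMonoidalOn (StarAutonomous.monoidal S) (Carrier Q) (_≈_ Q)
                      (Fixed S Q ω) (⋁ȷ S Q ω) (Qȷ₁ S Q ω) (uȷ S Q ω) (μȷ S Q ω)
mainTheorem13 S Q ω = μ-ȷ-laxˡ ω , Qȷ-isMonoidal ω
  where open MonoidalSLattFunctorProperties S Q
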